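{- Let $n\ge1$ and start the chip-firing game on the quadrant lattice graph with $2^n$ chips at $(0,0)$. Then in the stable configuration, no vertex $(x,x)$ on the line $y=x$ holds a chip.
   Context: The quadrant lattice graph is the directed graph with vertex set $\{(x,y): x,y\in\mathbb{Z}_{\ge 0}\}$ and edges $(x,y)\to(x+1,y)$ and $(x,y)\to(x,y+1)$. In the chip-firing game, a vertex holding at least $2$ chips may fire, sending one chip to each of its two out-neighbours. Starting from $2^n$ chips at $(0,0)$ the process terminates at a stable configuration (no vertex can fire), which does not depend on the order of firings. -}

module Defs where

open import Data.Nat using (ℕ; zero; suc; _+_; _∸_; _^_; _<_; _≤_; _≟_)
open import Data.Bool using (Bool; true; false; if_then_else_; _∧_)
open import Data.Product using (Σ; _×_; _,_; ∃-syntax)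
open import Relation.Nullary.Decidable using (⌊_⌋)
open import Relation.Binary.PropositionalEquality using (_≡_)
open import Relation.Binary.Construct.Closure.ReflexiveTransitive using (Star)

Config : Set
Config = ℕ → ℕ → ℕ

_,_≐_,_ : ℕ → ℕ → ℕ → ℕ → Bool
a , b ≐ x , y = ⌊ a ≟ x ⌋ ∧ ⌊ b ≟ y ⌋

fire : Config → ℕ → ℕ → Config
fire c x y a b =
  if (a , b ≐ x , y) then c a b ∸ 2
  else if (a , b ≐ suc x , y) then suc (c a b)
  else if (a , b ≐ x , suc y) then suc (c a b)
  else c a b

Step : Config → Config → Set
Step c d = ∃[ x ] ∃[ y ] (2 ≤ c x y × (∀ a b → d a b ≡ fire c x y a b))

Reaches : Config → Config → Set
Reaches = Star Step

Stable : Config → Set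
Stable c = ∀ x y → c x y < 2

initial : ℕ → Config
initial n a b = if (a , b ≐ 0 , 0) then 2 ^ n else 0

{-# OPTIONS --safe #-}
module Submission where

-- Record a run from s to c by its odometer f, the number of times each vertex fires; chip
-- conservation reads c + 2f = s + inflow f, where inflow f (a , b) = f (a-1 , b) + f (a , b-1).
-- Least action principle: the odometer of any run from s is bounded by any odometer from s to a
-- stable configuration t, because a vertex that has already fired as often as in t holds at most
-- as many chips as in t, i.e. fewer than 2, and so cannot fire again.
-- The initial configuration is symmetric, so transposing the final odometer f yields an odometer
-- fᵀ of the (stable) transposed configuration; hence f ≤ fᵀ, i.e. f is symmetric. On the diagonal
-- the inflow f (x-1 , x) + f (x , x-1) is then even, and so is 2ⁿ, hence c (x , x) is even and < 2.

open import Defs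
open import Data.Bool using (true; false; if_then_else_; _∧_)
open import Data.Bool.Properties using (∧-comm; ∧-zeroʳ)
open import Data.Nat using (ℕ; zero; suc; _+_; _*_; _^_; _≤_; _<_; _≟_; z≤n; s≤s)
open import Data.Nat.Divisibility using (_∣_; _∣0; m∣m*n; ∣⇒≤; ∣m∣n⇒∣m+n; ∣m+n∣m⇒∣n)
open import Data.Nat.Properties
  using (≤-trans; module ≤-Reasoning; +-assoc; ≤-antisym; <⇒≱; +-comm; +-identityʳ; +-cancelˡ-≡; *-cancelˡ-≡; +-cancelʳ-≤; +-monoʳ-≤; +-mono-≤; m∸n+n≡m; m≤n⇒m<n∨m≡n)
open import Data.Nat.Tactic.RingSolver using (solve-∀)
open import Data.Product using (_×_; _,_; ∃-syntax)
open import Data.Sum using (inj₁; inj₂)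
open import Relation.Nullary using (yes; no; contradiction)
open import Relation.Nullary.Decidable using (⌊_⌋; isYes≗does)
open import Relation.Binary.PropositionalEquality using (_≡_; refl; sym; trans; cong; cong₂; subst; module ≡-Reasoning)
open import Relation.Binary.Construct.Closure.ReflexiveTransitive using (ε; _◅_)

_⊕_ : Config → Config → Config
(f ⊕ g) a b = f a b + g a b

_≤ᶜ_ : Config → Config → Set
f ≤ᶜ g = ∀ a b → f a b ≤ g a b

transpose : Config → Config
transpose c a b = c b a

Symmetric : Config → Set
Symmetric c = ∀ a b → c a b ≡ c b a

unit : ℕ → ℕ → Config
unit x y a b = if (a , b ≐ x , y) then 1 else 0

fromLeft : Config → ℕ → ℕ → ℕ
fromLeft f zero    b = 0
fromLeft f (suc a) b = f a b

fromBelow : Config → ℕ → ℕ → ℕ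
fromBelow f a zero    = 0
fromBelow f a (suc b) = f a b

inflow : Config → ℕ → ℕ → ℕ
inflow f a b = fromLeft f a b + fromBelow f a b

record Odometer (s c f : Config) : Set where
  constructor odometer
  field balance : ∀ a b → c a b + 2 * f a b ≡ s a b + inflow f a b

open Odometer

inflow-⊕ : ∀ f g a b → inflow (f ⊕ g) a b ≡ inflow f a b + inflow g a b
inflow-⊕ f g a b =
  trans (cong₂ _+_ (fromLeft-⊕ a) (fromBelow-⊕ b))
        (interchange (fromLeft f a b) (fromLeft g a b) (fromBelow f a b) (fromBelow g a b))
  where
  fromLeft-⊕ : ∀ a → fromLeft (f ⊕ g) a b ≡ fromLeft f a b + fromLeft g a b
  fromLeft-⊕ zero    = refl
  fromLeft-⊕ (suc a) = refl
  fromBelow-⊕ : ∀ b → fromBelow (f ⊕ g) a b ≡ fromBelow f a b + fromBelow g a b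
  fromBelow-⊕ zero    = refl
  fromBelow-⊕ (suc b) = refl
  interchange : ∀ p q r s → (p + q) + (r + s) ≡ (p + r) + (q + s)
  interchange = solve-∀

inflow-mono : ∀ {f g} → f ≤ᶜ g → ∀ a b → inflow f a b ≤ inflow g a b
inflow-mono {f} {g} f≤g a b = +-mono-≤ (fromLeft-mono a) (fromBelow-mono b)
  where
  fromLeft-mono : ∀ a → fromLeft f a b ≤ fromLeft g a b
  fromLeft-mono zero    = z≤n
  fromLeft-mono (suc a) = f≤g a b
  fromBelow-mono : ∀ b → fromBelow f a b ≤ fromBelow g a b
  fromBelow-mono zero    = z≤n
  fromBelow-mono (suc b) = f≤g a b

inflow-transpose : ∀ f a b → inflow (transpose f) a b ≡ inflow f b a
inflow-transpose f a b =
  trans (cong₂ _+_ (fromLeft-transpose a) (fromBelow-transpose b)) (+-comm (fromBelow f b a) (fromLeft f b a))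
  where
  fromLeft-transpose : ∀ a → fromLeft (transpose f) a b ≡ fromBelow f b a
  fromLeft-transpose zero    = refl
  fromLeft-transpose (suc a) = refl
  fromBelow-transpose : ∀ b → fromBelow (transpose f) a b ≡ fromLeft f b a
  fromBelow-transpose zero    = refl
  fromBelow-transpose (suc b) = refl

inflow-diagonal : ∀ {f} → Symmetric f → ∀ x → inflow f (suc x) (suc x) ≡ 2 * f x (suc x)
inflow-diagonal {f} sym-f x = cong (f x (suc x) +_) (trans (sym-f (suc x) x) (sym (+-identityʳ _)))

≟-suc : ∀ a x → ⌊ suc a ≟ suc x ⌋ ≡ ⌊ a ≟ x ⌋
≟-suc a x = trans (isYes≗does (suc a ≟ suc x)) (sym (isYes≗does (a ≟ x)))

inflow-unit : ∀ x y a b → inflow (unit x y) a b ≡ unit (suc x) y a b + unit x (suc y) a b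
inflow-unit x y a b = cong₂ _+_ (fromLeft-unit a) (fromBelow-unit b)
  where
  fromLeft-unit : ∀ a → fromLeft (unit x y) a b ≡ unit (suc x) y a b
  fromLeft-unit zero    = refl
  fromLeft-unit (suc a) = cong (λ t → if t ∧ ⌊ b ≟ y ⌋ then 1 else 0) (sym (≟-suc a x))
  fromBelow-unit : ∀ b → fromBelow (unit x y) a b ≡ unit x (suc y) a b
  fromBelow-unit zero    = cong (if_then 1 else 0) (sym (∧-zeroʳ ⌊ a ≟ x ⌋))
  fromBelow-unit (suc b) = cong (λ t → if ⌊ a ≟ x ⌋ ∧ t then 1 else 0) (sym (≟-suc b y))

fire-balance : ∀ c x y → 2 ≤ c x y → ∀ a b →
  fire c x y a b + 2 * unit x y a b ≡ c a b + (unit (suc x) y a b + unit x (suc y) a b)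
fire-balance c x y 2≤c a b with a ≟ x | a ≟ suc x | b ≟ y | b ≟ suc y
... | yes refl | yes ()   | _        | _
... | yes refl | no _     | yes refl | yes ()
... | yes refl | no _     | yes refl | no _     = trans (m∸n+n≡m 2≤c) (sym (+-identityʳ _))
... | yes refl | no _     | no _     | yes refl = trans (+-identityʳ _) (+-comm 1 (c a b))
... | yes refl | no _     | no _     | no _     = refl
... | no _     | yes refl | yes refl | _        = trans (+-identityʳ _) (+-comm 1 (c a b))
... | no _     | yes refl | no _     | _        = refl
... | no _     | no _     | _        | _        = refl

step-odometer : ∀ {c d} → Step c d → ∃[ x ] ∃[ y ] 2 ≤ c x y × Odometer c d (unit x y)
step-odometer {c} {d} (x , y , 2≤c , d≗fire) = x , y , 2≤c , odometer λ a b → begin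
  d a b + 2 * unit x y a b                           ≡⟨ cong (_+ 2 * unit x y a b) (d≗fire a b) ⟩
  fire c x y a b + 2 * unit x y a b                  ≡⟨ fire-balance c x y 2≤c a b ⟩
  c a b + (unit (suc x) y a b + unit x (suc y) a b)  ≡⟨ cong (c a b +_) (inflow-unit x y a b) ⟨
  c a b + inflow (unit x y) a b                      ∎
  where open ≡-Reasoning

odometer-refl : ∀ s → Odometer s s (λ _ _ → 0)
odometer-refl s = odometer balance₀
  where
  balance₀ : ∀ a b → s a b + 2 * 0 ≡ s a b + inflow (λ _ _ → 0) a b
  balance₀ zero    zero    = refl
  balance₀ zero    (suc b) = refl
  balance₀ (suc a) zero    = refl
  balance₀ (suc a) (suc b) = refl

odometer-trans : ∀ {s c d f g} → Odometer s c f → Odometer c d g → Odometer s d (f ⊕ g)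
odometer-trans {s} {c} {d} {f} {g} o₁ o₂ = odometer λ a b → begin
  d a b + 2 * (f a b + g a b)                  ≡⟨ split (d a b) (g a b) (f a b) ⟩
  (d a b + 2 * g a b) + 2 * f a b              ≡⟨ cong (_+ 2 * f a b) (balance o₂ a b) ⟩
  (c a b + inflow g a b) + 2 * f a b           ≡⟨ swap (c a b) (inflow g a b) (2 * f a b) ⟩
  (c a b + 2 * f a b) + inflow g a b           ≡⟨ cong (_+ inflow g a b) (balance o₁ a b) ⟩
  (s a b + inflow f a b) + inflow g a b        ≡⟨ +-assoc (s a b) _ _ ⟩
  s a b + (inflow f a b + inflow g a b)        ≡⟨ cong (s a b +_) (inflow-⊕ f g a b) ⟨
  s a b + inflow (f ⊕ g) a b                   ∎
  where
  open ≡-Reasoning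
  split : ∀ p q r → p + 2 * (r + q) ≡ (p + 2 * q) + 2 * r
  split = solve-∀
  swap : ∀ p q r → (p + q) + r ≡ (p + r) + q
  swap = solve-∀

reaches-odometer : ∀ {s c} → Reaches s c → ∃[ f ] Odometer s c f
reaches-odometer {s} ε = _ , odometer-refl s
reaches-odometer (step ◅ steps) with step-odometer step | reaches-odometer steps
... | _ , _ , _ , o₁ | _ , o₂ = _ , odometer-trans o₁ o₂

odometer-unique : ∀ {s c f g} → Odometer s c f → Odometer s c g → ∀ a b → f a b ≡ g a b
odometer-unique {s} {c} {f} {g} o₁ o₂ = agree
  where
  agree : ∀ a b → f a b ≡ g a b
  fromLeft-agree : ∀ a b → fromLeft f a b ≡ fromLeft g a b
  fromBelow-agree : ∀ a b → fromBelow f a b ≡ fromBelow g a b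

  agree a b = *-cancelˡ-≡ (f a b) (g a b) 2 (+-cancelˡ-≡ (c a b) _ _ (begin
    c a b + 2 * f a b    ≡⟨ balance o₁ a b ⟩
    s a b + inflow f a b ≡⟨ cong (s a b +_) (cong₂ _+_ (fromLeft-agree a b) (fromBelow-agree a b)) ⟩
    s a b + inflow g a b ≡⟨ balance o₂ a b ⟨
    c a b + 2 * g a b    ∎))
    where open ≡-Reasoning

  fromLeft-agree zero    b = refl
  fromLeft-agree (suc a) b = agree a b

  fromBelow-agree a zero    = refl
  fromBelow-agree a (suc b) = agree a b

fires-below-stable-odometer : ∀ {s c t f g x y} → Stable t → Odometer s t f → Odometer s c g → g ≤ᶜ f →
  2 ≤ c x y → g x y < f x y
fires-below-stable-odometer {s} {c} {t} {f} {g} {x} {y} stable oₜ o g≤f 2≤c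
  with m≤n⇒m<n∨m≡n (g≤f x y)
... | inj₁ g<f = g<f
... | inj₂ g≡f = contradiction (≤-trans 2≤c c≤t) (<⇒≱ (stable x y))
  where
  c≤t : c x y ≤ t x y
  c≤t = +-cancelʳ-≤ (2 * f x y) (c x y) (t x y) (begin
    c x y + 2 * f x y    ≡⟨ cong (λ k → c x y + 2 * k) g≡f ⟨
    c x y + 2 * g x y    ≡⟨ balance o x y ⟩
    s x y + inflow g x y ≤⟨ +-monoʳ-≤ (s x y) (inflow-mono g≤f x y) ⟩
    s x y + inflow f x y ≡⟨ balance oₜ x y ⟨
    t x y + 2 * f x y    ∎)
    where open ≤-Reasoning

⊕unit-≤ᶜ : ∀ {f g x y} → g ≤ᶜ f → g x y < f x y → (g ⊕ unit x y) ≤ᶜ f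
⊕unit-≤ᶜ {f} {g} {x} {y} g≤f g<f a b with a ≟ x | b ≟ y
... | yes refl | yes refl = subst (_≤ f a b) (+-comm 1 (g a b)) g<f
... | yes refl | no _     = subst (_≤ f a b) (sym (+-identityʳ (g a b))) (g≤f a b)
... | no _     | _        = subst (_≤ f a b) (sym (+-identityʳ (g a b))) (g≤f a b)

odometer-bounded : ∀ {s c d t f g} → Stable t → Odometer s t f → Odometer s c g → g ≤ᶜ f →
  Reaches c d → ∃[ h ] Odometer s d h × h ≤ᶜ f
odometer-bounded _ _ o g≤f ε = _ , o , g≤f
odometer-bounded stable oₜ o g≤f (step ◅ steps) with step-odometer step
... | _ , _ , 2≤c , oₛ =
  odometer-bounded stable oₜ (odometer-trans o oₛ)
    (⊕unit-≤ᶜ g≤f (fires-below-stable-odometer stable oₜ o g≤f 2≤c)) steps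

least-action : ∀ {s c t f g} → Stable t → Odometer s t f → Reaches s c → Odometer s c g → g ≤ᶜ f
least-action {s} {f = f} stable oₜ run o a b
  with odometer-bounded stable oₜ (odometer-refl s) (λ _ _ → z≤n) run
... | h , oₕ , h≤f = subst (_≤ f a b) (odometer-unique oₕ o a b) (h≤f a b)

odometer-transpose : ∀ {s c f} → Symmetric s → Odometer s c f → Odometer s (transpose c) (transpose f)
odometer-transpose {s} {c} {f} sym-s o = odometer λ a b → begin
  c b a + 2 * f b a               ≡⟨ balance o b a ⟩
  s b a + inflow f b a            ≡⟨ cong₂ _+_ (sym-s a b) (inflow-transpose f a b) ⟨
  s a b + inflow (transpose f) a b ∎
  where open ≡-Reasoning

odometer-symmetric : ∀ {s c f} → Symmetric s → Reaches s c → Stable c → Odometer s c f → Symmetric f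
odometer-symmetric {f = f} sym-s run stable o a b = ≤-antisym (f≤fᵀ a b) (f≤fᵀ b a)
  where
  f≤fᵀ : f ≤ᶜ transpose f
  f≤fᵀ = least-action (λ a b → stable b a) (odometer-transpose sym-s o) run o

diagonal-even : ∀ {s c f} → Odometer s c f → Symmetric f → ∀ x → 2 ∣ s x x → 2 ∣ c x x
diagonal-even {s} {c} {f} o sym-f x 2∣s = ∣m+n∣m⇒∣n 2∣2f+c (m∣m*n (f x x))
  where
  2∣inflow : ∀ x → 2 ∣ inflow f x x
  2∣inflow zero    = 2 ∣0
  2∣inflow (suc x) = subst (2 ∣_) (sym (inflow-diagonal sym-f x)) (m∣m*n (f x (suc x)))
  2∣2f+c : 2 ∣ 2 * f x x + c x x
  2∣2f+c = subst (2 ∣_) (trans (sym (balance o x x)) (+-comm (c x x) _)) (∣m∣n⇒∣m+n 2∣s (2∣inflow x))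

initial-symmetric : ∀ n → Symmetric (initial n)
initial-symmetric n a b = cong (if_then 2 ^ n else 0) (∧-comm ⌊ a ≟ 0 ⌋ ⌊ b ≟ 0 ⌋)

initial-even : ∀ m a b → 2 ∣ initial (suc m) a b
initial-even m a b with a , b ≐ 0 , 0
... | true  = m∣m*n (2 ^ m)
... | false = 2 ∣0

even<2⇒≡0 : ∀ {m} → 2 ∣ m → m < 2 → m ≡ 0
even<2⇒≡0 {zero}        _   _                 = refl
even<2⇒≡0 {suc zero}    2∣1 _                 = contradiction (∣⇒≤ 2∣1) λ { (s≤s ()) }
even<2⇒≡0 {suc (suc m)} _   (s≤s (s≤s ()))

corollary4p6 : (n : ℕ) → 1 ≤ n → (c : Config) → Reaches (initial n) c → Stable c →
    (x : ℕ) → c x x ≡ 0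
corollary4p6 (suc m) _ c run stable x with reaches-odometer run
... | f , o = even<2⇒≡0 c-even (stable x x)
  where
  f-symmetric : Symmetric f
  f-symmetric = odometer-symmetric (initial-symmetric (suc m)) run stable o
  c-even : 2 ∣ c x x
  c-even = diagonal-even o f-symmetric x (initial-even m x x)
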